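{- Let $S[1\ldots n]$ be a string. For each $p\in\{1,\ldots,n\}$ let $\mathrm{LLR}_p$ be the left-bounded longest repeat starting at $p$, recorded as the pair $\langle p,\ell_p\rangle$ (start, length) with $\ell_p=0$ if it does not exist. Let $LLRS[1\ldots n]$ be the list of these $n$ pairs stably sorted (from the order $p=1,\ldots,n$) in descending order of length. Let $P_1$ be the set of positions covered by $LLRS[1]$, and for $2\le i\le n$ let $P_i$ be the set of positions covered by $LLRS[i]$ but not by any of $LLRS[1],\ldots,LLRS[i-1]$ (a pair of length $0$ covers no position). Then for every position $k$ such that $S[k]$ occurs at least twice in $S$, there is an index $i$ with $k\in P_i$, and for every $i$ and every $k\in P_i$, the substring represented by $LLRS[i]$ is the leftmost longest repeat covering position $k$.
   Context: For a string $S[1\ldots n]$, $S[i\ldots j]=S[i]\cdots S[j]$, which covers position $k$ if $i\le k\le j$; a pair $\langle p,\ell\rangle$ with $\ell>0$ represents $S[p\ldots p+\ell-1]$. A substring $S[i\ldots j]$ is unique if there is no other substring $S[i'\ldots j']$ equal to it with $i'\neq i$; a repeat is a non-unique substring. The left-bounded longest repeat starting at $p$ is the repeat $S[p\ldots q]$ such that either $q=n$ or $S[p\ldots q+1]$ is unique. A longest repeat covering $k$ is a repeat $S[i\ldots j]$ with $i\le k\le j$ such that no repeat $S[i'\ldots j']$ with $i'\le k\le j'$ has $j'-i'>j-i$; the leftmost one is the one with smallest starting position. -}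

module Defs where

open import Data.Nat using (ℕ; zero; suc; _+_; _∸_; _≤_; _<_)
open import Data.List using (List; length; take; drop; head; applyUpTo)
open import Data.Maybe using (Maybe)
open import Data.Vec using (Vec; lookup; toList)
open import Data.Fin using (Fin; toℕ)
open import Data.Product using (_×_; _,_; ∃; proj₁; proj₂)
open import Data.Sum using (_⊎_)
open import Relation.Nullary using (¬_)
open import Relation.Binary.PropositionalEquality using (_≡_; _≢_)
open import Data.List.Relation.Binary.Permutation.Propositional using (_↭_)
open import Data.List.Relation.Unary.Linked using (Linked)

Covers : ℕ × ℕ → ℕ → Set
Covers (p , ℓ) k = p ≤ k × k < p + ℓ

-- Strings are lists; positions are 1-based natural numbers.
module _ {A : Set} where

  charAt : List A → ℕ → Maybe A
  charAt S k = head (drop (k ∸ 1) S)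

  substr : List A → ℕ → ℕ → List A
  substr S p ℓ = take ℓ (drop (p ∸ 1) S)

  Valid : List A → ℕ → ℕ → Set
  Valid S p ℓ = 1 ≤ p × 0 < ℓ × p + ℓ ∸ 1 ≤ length S

  Unique : List A → ℕ → ℕ → Set
  Unique S p ℓ = Valid S p ℓ ×
    (∀ p' ℓ' → p' ≢ p → Valid S p' ℓ' → ¬ (substr S p' ℓ' ≡ substr S p ℓ))

  Repeat : List A → ℕ → ℕ → Set
  Repeat S p ℓ = Valid S p ℓ ×
    ∃ λ p' → ∃ λ ℓ' → p' ≢ p × Valid S p' ℓ' × substr S p' ℓ' ≡ substr S p ℓ

  IsLLR : List A → ℕ → ℕ → Set
  IsLLR S p ℓ = Repeat S p ℓ × (p + ℓ ∸ 1 ≡ length S ⊎ Unique S p (suc ℓ))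

  LLRLengths : List A → (ℕ → ℕ) → Set
  LLRLengths S len = ∀ p → 1 ≤ p → p ≤ length S →
    IsLLR S p (len p) ⊎ (len p ≡ 0 × (∀ ℓ → ¬ IsLLR S p ℓ))

  llrList : List A → (ℕ → ℕ) → List (ℕ × ℕ)
  llrList S len = applyUpTo (λ i → suc i , len (suc i)) (length S)

  LeftmostLongestRepeatCovering : List A → ℕ → ℕ × ℕ → Set
  LeftmostLongestRepeatCovering S k (p , ℓ) =
    Repeat S p ℓ × Covers (p , ℓ) k ×
    (∀ p' ℓ' → Repeat S p' ℓ' → Covers (p' , ℓ') k → ℓ' ≤ ℓ) ×
    (∀ p' → Repeat S p' ℓ → Covers (p' , ℓ) k → p ≤ p')

  OccursTwice : List A → ℕ → Set
  OccursTwice S k = 1 ≤ k × k ≤ length S ×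
    ∃ λ k' → k' ≢ k × 1 ≤ k' × k' ≤ length S × charAt S k' ≡ charAt S k

-- order of a stable sort by descending length of the list ⟨1,ℓ_1⟩,…,⟨n,ℓ_n⟩:
-- longer first; equal lengths keep the original order (i.e. increasing start p)
StableDescBefore : ℕ × ℕ → ℕ × ℕ → Set
StableDescBefore (p , ℓ) (p' , ℓ') = ℓ' < ℓ ⊎ (ℓ ≡ ℓ' × p < p')

IsLLRS : {A : Set} (S : List A) → (ℕ → ℕ) → Vec (ℕ × ℕ) (length S) → Set
IsLLRS S len LLRS = (toList LLRS ↭ llrList S len) × Linked {A = ℕ × ℕ} StableDescBefore (toList LLRS)

-- k ∈ P_i  (index i is 0-based as a Fin: i = 0 corresponds to LLRS[1])
InP : {n : ℕ} → Vec (ℕ × ℕ) n → Fin n → ℕ → Set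
InP LLRS i k = Covers (lookup LLRS i) k × (∀ j → toℕ j < toℕ i → ¬ Covers (lookup LLRS j) k)

-- Repeats are closed under taking nonempty prefixes, so every repeat starting at a is a prefix of
-- LLR_a and ℓ_a is the length of the longest repeat starting at a. Hence any repeat covering k
-- stretches to an LLR covering k that is at least as long. The first entry of LLRS covering k
-- therefore has maximal length among all repeats covering k, and, since the sort is stable,
-- among those of maximal length it has the smallest start.
module Submission where

open import Defs
open import Data.Nat using (ℕ; zero; suc; _+_; _∸_; _≤_; _<_; z≤n; s≤s; s<s⁻¹; _≤?_; _<?_)
open import Data.Nat.Properties
open import Data.List using (List; []; _∷_; length; take; drop; head)
open import Data.List.Properties using (take-take; length-take; length-drop)
open import Data.List.Membership.Propositional.Properties using (∈-applyUpTo⁺; ∈-applyUpTo⁻)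
open import Data.List.Relation.Binary.Permutation.Propositional using (_↭_; ↭-sym)
open import Data.List.Relation.Binary.Permutation.Propositional.Properties using (∈-resp-↭)
import Data.List.Relation.Unary.Linked as ListLinked
open import Data.Vec using (Vec; lookup; toList; _∷_; [])
open import Data.Vec.Membership.Propositional.Properties using (∈-lookup; ∈-toList⁺; ∈-toList⁻)
open import Data.Vec.Relation.Unary.Any using (index)
open import Data.Vec.Relation.Unary.Any.Properties using (lookup-index)
import Data.Vec.Relation.Unary.Linked as VecLinked
open import Data.Vec.Relation.Unary.Linked.Properties using (lookup⁺)
open import Data.Fin using (Fin; toℕ; zero; suc)
open import Data.Fin.Properties using () renaming (<-cmp to <-cmp-Fin)
open import Data.Product using (_×_; ∃; _,_; proj₁)
open import Data.Sum using (inj₁; inj₂)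
open import Data.Empty using (⊥-elim)
open import Function using (_∘_)
open import Relation.Nullary using (¬_; yes; no; contradiction)
open import Relation.Nullary.Decidable using (Dec; _×-dec_)
open import Relation.Unary using (Decidable)
open import Relation.Binary.Core using (Rel)
open import Relation.Binary.Definitions using (Transitive; Irreflexive; tri<; tri≈; tri>)
open import Relation.Binary.PropositionalEquality
  using (_≡_; _≢_; refl; sym; trans; cong; subst; subst₂; module ≡-Reasoning)

covers? : ∀ k x → Dec (Covers x k)
covers? k (p , ℓ) = (p ≤? k) ×-dec (k <? p + ℓ)

Covers⇒0< : ∀ {p ℓ k} → Covers (p , ℓ) k → 0 < ℓ
Covers⇒0< {p} {zero} {k} (p≤k , k<p+0) =
  contradiction p≤k (<⇒≱ (subst (k <_) (+-identityʳ p) k<p+0))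
Covers⇒0< {ℓ = suc _} _ = s≤s z≤n

Covers-self : ∀ {p ℓ} → 0 < ℓ → Covers (p , ℓ) p
Covers-self {p} 0<ℓ = ≤-refl , m<m+n p 0<ℓ

Covers-mono : ∀ {p ℓ ℓ' k} → ℓ ≤ ℓ' → Covers (p , ℓ) k → Covers (p , ℓ') k
Covers-mono {p} ℓ≤ℓ' (p≤k , k<p+ℓ) = p≤k , <-≤-trans k<p+ℓ (+-monoʳ-≤ p ℓ≤ℓ')

head≡⇒take1≡ : ∀ {A : Set} (xs ys : List A) → head xs ≡ head ys → take 1 xs ≡ take 1 ys
head≡⇒take1≡ []       []       _    = refl
head≡⇒take1≡ (x ∷ xs) (y ∷ ys) refl = refl

module _ {A : Set} (S : List A) where

  Valid⇒inRange : ∀ {p ℓ} → Valid S p ℓ → 1 ≤ p × p ≤ length S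
  Valid⇒inRange {suc p} (1≤p , 0<ℓ , fits) = 1≤p , <-≤-trans (m<m+n p 0<ℓ) fits

  inRange⇒Valid₁ : ∀ {p} → 1 ≤ p → p ≤ length S → Valid S p 1
  inRange⇒Valid₁ {suc p} 1≤p p<n = 1≤p , s≤s z≤n , subst (_≤ length S) (+-comm 1 p) p<n

  Valid-prefix : ∀ {p ℓ l} → 0 < l → l ≤ ℓ → Valid S p ℓ → Valid S p l
  Valid-prefix {p} 0<l l≤ℓ (1≤p , _ , fits) =
    1≤p , 0<l , ≤-trans (∸-monoˡ-≤ 1 (+-monoʳ-≤ p l≤ℓ)) fits

  Valid⇒≢end : ∀ {p L} → Valid S p (suc L) → p + L ∸ 1 ≢ length S
  Valid⇒≢end {suc p} {L} (_ , _ , fits) ends = <-irrefl ends (subst (_≤ length S) (+-suc p L) fits)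

  length-substr : ∀ {p ℓ} → Valid S p ℓ → length (substr S p ℓ) ≡ ℓ
  length-substr {suc p} {ℓ} (_ , _ , fits) =
    trans (length-take ℓ (drop p S))
          (m≤n⇒m⊓n≡m (subst (ℓ ≤_) (sym (length-drop p S)) ℓ≤n∸p))
    where
    ℓ≤n∸p : ℓ ≤ length S ∸ p
    ℓ≤n∸p = m+n≤o⇒m≤o∸n ℓ (subst (_≤ length S) (+-comm p ℓ) fits)

  length-substr≤ : ∀ p ℓ → length (substr S p ℓ) ≤ ℓ
  length-substr≤ p ℓ = subst (_≤ ℓ) (sym (length-take ℓ (drop (p ∸ 1) S))) (m⊓n≤m ℓ _)

  take-substr : ∀ p {l ℓ} → l ≤ ℓ → take l (substr S p ℓ) ≡ substr S p l
  take-substr p {l} {ℓ} l≤ℓ =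
    trans (take-take l ℓ (drop (p ∸ 1) S))
          (cong (λ n → take n (drop (p ∸ 1) S)) (m≤n⇒m⊓n≡m l≤ℓ))

  OccursTwice⇒Repeat : ∀ {k} → OccursTwice S k → Repeat S k 1
  OccursTwice⇒Repeat {suc k} (1≤k , k≤n , suc k' , k'≢k , 1≤k' , k'≤n , same-char) =
    inRange⇒Valid₁ 1≤k k≤n , suc k' , 1 , k'≢k , inRange⇒Valid₁ 1≤k' k'≤n ,
    head≡⇒take1≡ (drop k' S) (drop k S) same-char

  Repeat-prefix : ∀ {p m l} → 0 < l → l ≤ m → Repeat S p m → Repeat S p l
  Repeat-prefix {p} {m} {l} 0<l l≤m (valid , p' , ℓ' , p'≢p , valid' , same) =
    Valid-prefix 0<l l≤m valid , p' , l , p'≢p , Valid-prefix 0<l l≤ℓ' valid' , same-prefix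
    where
    open ≡-Reasoning
    l≤ℓ' : l ≤ ℓ'
    l≤ℓ' = ≤-trans l≤m (subst (_≤ ℓ') (trans (cong length same) (length-substr valid))
                               (length-substr≤ p' ℓ'))
    same-prefix : substr S p' l ≡ substr S p l
    same-prefix = begin
      substr S p' l           ≡⟨ take-substr p' l≤ℓ' ⟨
      take l (substr S p' ℓ') ≡⟨ cong (take l) same ⟩
      take l (substr S p m)   ≡⟨ take-substr p l≤m ⟩
      substr S p l            ∎

  LLR-longest : ∀ {p m L} → Repeat S p m → IsLLR S p L → m ≤ L
  LLR-longest {m = m} {L} rep (_ , ends-or-unique) with m ≤? L
  ... | yes m≤L = m≤L
  ... | no m≰L with ends-or-unique | Repeat-prefix (s≤s z≤n) (≰⇒> m≰L) rep
  ...   | inj₁ ends              | (valid , _) = contradiction ends (Valid⇒≢end valid)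
  ...   | inj₂ (_ , unrepeated)  | (_ , p' , ℓ' , p'≢p , valid' , same) =
    contradiction same (unrepeated p' ℓ' p'≢p valid')

  -- Uniqueness is undecidable, so an LLR is only obtained up to double negation: extend the
  -- repeat one character at a time until it reaches the end of S or becomes unique.
  Repeat⇒¬¬LLR : ∀ {p m} → Repeat S p m → ¬ (∀ ℓ → ¬ IsLLR S p ℓ)
  Repeat⇒¬¬LLR {suc p} {m} rep@((_ , _ , fits) , _) =
    extend m (length S ∸ (p + m)) (m+[n∸m]≡n fits) rep
    where
    extend : ∀ m d → p + m + d ≡ length S → Repeat S (suc p) m → ¬ (∀ ℓ → ¬ IsLLR S (suc p) ℓ)
    extend m zero ends rep noLLR = noLLR m (rep , inj₁ (trans (sym (+-identityʳ (p + m))) ends))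
    extend m (suc d) ends rep noLLR = noLLR m (rep , inj₂ (longer , λ p' ℓ' p'≢p valid' same →
      extend (suc m) d ends' (longer , p' , ℓ' , p'≢p , valid' , same) noLLR))
      where
      ends' : p + suc m + d ≡ length S
      ends' = trans (cong (_+ d) (+-suc p m)) (trans (sym (+-suc (p + m) d)) ends)
      longer : Valid S (suc p) (suc m)
      longer = s≤s z≤n , s≤s z≤n , subst (p + suc m ≤_) ends' (m≤m+n (p + suc m) d)

module _ {A : Set} {S : List A} {len : ℕ → ℕ} (lengths : LLRLengths S len) where

  Repeat⇒≤len : ∀ {p m} → Repeat S p m → m ≤ len p
  Repeat⇒≤len rep with Valid⇒inRange S (proj₁ rep)
  ... | 1≤p , p≤n with lengths _ 1≤p p≤n
  ...   | inj₁ llr          = LLR-longest S rep llr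
  ...   | inj₂ (_ , noLLR) = ⊥-elim (Repeat⇒¬¬LLR S rep noLLR)

  0<len⇒Repeat : ∀ {p} → 1 ≤ p → p ≤ length S → 0 < len p → Repeat S p (len p)
  0<len⇒Repeat 1≤p p≤n 0<len with lengths _ 1≤p p≤n
  ... | inj₁ llr       = proj₁ llr
  ... | inj₂ (len≡0 , _) = contradiction (sym len≡0) (<⇒≢ 0<len)

StableDescBefore-trans : Transitive StableDescBefore
StableDescBefore-trans (inj₁ ℓ₂<ℓ₁)          (inj₁ ℓ₃<ℓ₂)          = inj₁ (<-trans ℓ₃<ℓ₂ ℓ₂<ℓ₁)
StableDescBefore-trans (inj₁ ℓ₂<ℓ₁)          (inj₂ (refl , _))     = inj₁ ℓ₂<ℓ₁
StableDescBefore-trans (inj₂ (refl , _))     (inj₁ ℓ₃<ℓ₂)          = inj₁ ℓ₃<ℓ₂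
StableDescBefore-trans (inj₂ (refl , p₁<p₂)) (inj₂ (refl , p₂<p₃)) = inj₂ (refl , <-trans p₁<p₂ p₂<p₃)

StableDescBefore-irrefl : Irreflexive _≡_ StableDescBefore
StableDescBefore-irrefl refl (inj₁ ℓ<ℓ)      = <-irrefl refl ℓ<ℓ
StableDescBefore-irrefl refl (inj₂ (_ , p<p)) = <-irrefl refl p<p

Linked-toList⁻ : ∀ {a} {X : Set} {R : Rel X a} {n} (xs : Vec X n) →
                 ListLinked.Linked R (toList xs) → VecLinked.Linked R xs
Linked-toList⁻ []           _                         = VecLinked.[]
Linked-toList⁻ (x ∷ [])     _                         = VecLinked.[-]
Linked-toList⁻ (x ∷ y ∷ xs) (Rxy ListLinked.∷ linked) =
  Rxy VecLinked.∷ Linked-toList⁻ (y ∷ xs) linked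

Linked-lookup⁻ : ∀ {a} {X : Set} {R : Rel X a} → Transitive R → Irreflexive _≡_ R →
                 ∀ {n} {xs : Vec X n} → VecLinked.Linked R xs →
                 ∀ i j → R (lookup xs j) (lookup xs i) → toℕ j < toℕ i
Linked-lookup⁻ R-trans R-irrefl linked i j Rji with <-cmp-Fin j i
... | tri< j<i _ _ = j<i
... | tri≈ _ refl _ = contradiction Rji (R-irrefl refl)
... | tri> _ _ i<j = ⊥-elim (R-irrefl refl (R-trans Rji (lookup⁺ R-trans linked i<j)))

least-index : ∀ {a} {n} (P : Fin n → Set a) → Decidable P → ∀ j → P j →
              ∃ λ i → P i × (∀ j → toℕ j < toℕ i → ¬ P j)
least-index {n = suc _} P P? j Pj with P? zero
... | yes P0 = zero , P0 , λ _ ()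
least-index P P? zero    Pj | no ¬P0 = contradiction Pj ¬P0
least-index P P? (suc j) Pj | no ¬P0 with least-index (P ∘ suc) (P? ∘ suc) j Pj
... | i , Pi , below = suc i , Pi , λ where
  zero    _   → ¬P0
  (suc j) j<i → below j (s<s⁻¹ j<i)

module _ {A : Set} {S : List A} {len : ℕ → ℕ} (lengths : LLRLengths S len)
         (LLRS : Vec (ℕ × ℕ) (length S)) (perm : toList LLRS ↭ llrList S len)
         (sorted : ListLinked.Linked StableDescBefore (toList LLRS)) where

  entry-of : ∀ i → ∃ λ p → 1 ≤ p × p ≤ length S × lookup LLRS i ≡ (p , len p)
  entry-of i with ∈-applyUpTo⁻ _ (∈-resp-↭ perm (∈-toList⁺ (∈-lookup i LLRS)))
  ... | p , p<n , entry = suc p , s≤s z≤n , p<n , entry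

  index-of : ∀ {p} → 1 ≤ p → p ≤ length S → ∃ λ j → lookup LLRS j ≡ (p , len p)
  index-of {suc p} _ p<n = index p∈LLRS , sym (lookup-index p∈LLRS)
    where
    p∈LLRS = ∈-toList⁻ (∈-resp-↭ (↭-sym perm) (∈-applyUpTo⁺ _ p<n))

  before⇒earlier : ∀ i j → StableDescBefore (lookup LLRS j) (lookup LLRS i) → toℕ j < toℕ i
  before⇒earlier =
    Linked-lookup⁻ StableDescBefore-trans StableDescBefore-irrefl (Linked-toList⁻ LLRS sorted)

  OccursTwice⇒inP : ∀ k → OccursTwice S k → ∃ λ i → InP LLRS i k
  OccursTwice⇒inP k twice@(1≤k , k≤n , _) with index-of 1≤k k≤n
  ... | j , entry = least-index (λ i → Covers (lookup LLRS i) k) (covers? k ∘ lookup LLRS) j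
    (subst (λ x → Covers x k) (sym entry)
           (Covers-self (Repeat⇒≤len lengths (OccursTwice⇒Repeat S twice))))

  -- A repeat covering k stretches to an LLR covering k, which cannot precede LLRS[i] since
  -- no entry before LLRS[i] covers k.
  inP⇒not-preceded : ∀ {i p k} → lookup LLRS i ≡ (p , len p) → InP LLRS i k →
                     ∀ {a m} → Repeat S a m → Covers (a , m) k →
                     ¬ StableDescBefore (a , len a) (p , len p)
  inP⇒not-preceded {i} {k = k} entry (_ , uncovered-before) rep cov before
    with Valid⇒inRange S (proj₁ rep)
  ... | 1≤a , a≤n with index-of 1≤a a≤n
  ...   | j , entry-a = uncovered-before j
    (before⇒earlier i j (subst₂ StableDescBefore (sym entry-a) (sym entry) before))
    (subst (λ x → Covers x k) (sym entry-a) (Covers-mono (Repeat⇒≤len lengths rep) cov))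

  inP⇒LeftmostLongest : ∀ i k → InP LLRS i k → LeftmostLongestRepeatCovering S k (lookup LLRS i)
  inP⇒LeftmostLongest i k inP@(cov , _) with entry-of i
  ... | p , 1≤p , p≤n , entry = subst (LeftmostLongestRepeatCovering S k) (sym entry)
    (rep-p , cov-p , longest , leftmost)
    where
    cov-p : Covers (p , len p) k
    cov-p = subst (λ x → Covers x k) entry cov
    rep-p : Repeat S p (len p)
    rep-p = 0<len⇒Repeat lengths 1≤p p≤n (Covers⇒0< cov-p)
    len≤ : ∀ {a m} → Repeat S a m → Covers (a , m) k → len a ≤ len p
    len≤ rep covA = ≮⇒≥ (inP⇒not-preceded entry inP rep covA ∘ inj₁)
    longest : ∀ a m → Repeat S a m → Covers (a , m) k → m ≤ len p
    longest a m rep covA = ≤-trans (Repeat⇒≤len lengths rep) (len≤ rep covA)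
    leftmost : ∀ a → Repeat S a (len p) → Covers (a , len p) k → p ≤ a
    leftmost a rep covA = ≮⇒≥ λ a<p →
      inP⇒not-preceded entry inP rep covA
        (inj₂ (≤-antisym (len≤ rep covA) (Repeat⇒≤len lengths rep) , a<p))

lemma5 : {A : Set} (S : List A) (len : ℕ → ℕ) → LLRLengths S len →
    (LLRS : Vec (ℕ × ℕ) (length S)) → IsLLRS S len LLRS →
    (∀ k → OccursTwice S k → ∃ λ i → InP LLRS i k) ×
    (∀ i k → InP LLRS i k → LeftmostLongestRepeatCovering S k (lookup LLRS i))
lemma5 S len lengths LLRS (perm , sorted) =
  OccursTwice⇒inP lengths LLRS perm sorted , inP⇒LeftmostLongest lengths LLRS perm sorted
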